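{- Let $r\ge2$ and $\Delta\ge1$ be integers. Then for $t=r^3\Delta^3$, any $\varepsilon\le|P^{(r)}(\Delta)|^{ -1}(t-1)^{ -1}$ and any $F\in\mathcal{F}^{(r)}(n,\Delta)$ there exists a partition $V(F)=X_0\cup\dots\cup X_t$ (where some $X_i$ may be empty) such that (1) $|X_t|=\varepsilon n$ and $X_0=N_F(X_t)$; (2) all $x\in X_t$ have the same profile $P_F(x)$ (up to equivalence); (3) $X_i$ is $3$-independent in $F$ for $i=1,\dots,t$.
   Context: $\mathcal{F}^{(r)}(n,\Delta)$ is the family of $r$-uniform hypergraphs on $n$ vertices with maximum degree at most $\Delta$. For an $r$-uniform hypergraph $H=(V,E)$ and $v\in V$: $N_H(v)=\{w\ne v:\exists e\in E,\ \{v,w\}\subseteq e\}$; for $W\subseteq V$, $N_H(W)=\bigcup_{w\in W}N_H(w)$; $\operatorname{link}_H(v)=\{e'\in\binom{V}{r-1}: e'\cup\{v\}\in E\}$. The profile of $v$ is $P_H(v)=(N_H(v),E(H[N_H(v)]),\operatorname{link}_H(v))$, where $H[W]=(W,E\cap\binom{W}{r})$. Two profiles $P_H(v_1),P_H(v_2)$ are equivalent if there is a bijection $N_H(v_1)\to N_H(v_2)$ that is simultaneously an isomorphism of $H[N_H(v_1)]$ onto $H[N_H(v_2)]$ and of $(N_H(v_1),\operatorname{link}_H(v_1))$ onto $(N_H(v_2),\operatorname{link}_H(v_2))$. $P^{(r)}(\Delta)$ is the (finite) set of equivalence classes of all profiles of vertices in hypergraphs belonging to $\bigcup_n\mathcal{F}^{(r)}(n,\Delta)$.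 A path of length $s$ from $u$ to $w$ is a sequence $v_1,e_1,\dots,e_s,v_{s+1}$ with $v_1=u$, $v_{s+1}=w$, $v_j,v_{j+1}\in e_j$; the distance is the minimal length of such a path. A set $W$ is $3$-independent if any two distinct vertices of $W$ have distance at least $4$. Floors/ceilings are ignored (e.g. $\varepsilon n$ is treated as an integer). -}

module Defs where

open import Data.Nat using (ℕ; zero; suc; _+_; _*_; _∸_; _^_; _≤_; _<_)
open import Data.Fin using (Fin; _≟_)
open import Data.Fin.Subset using (Subset; _∈_; ∣_∣)
open import Data.Fin.Subset.Properties using (_∈?_)
open import Data.List using (List; length; filter)
open import Data.List.Membership.Propositional renaming (_∈_ to _∈ₗ_)
open import Data.List.Relation.Unary.Unique.Propositional using (Unique)
open import Data.List.Relation.Unary.All using (All)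
open import Data.Product using (Σ; ∃; _×_; _,_)
open import Data.Vec using (tabulate)
open import Relation.Binary.PropositionalEquality using (_≡_; _≢_)
open import Relation.Nullary using (¬_)
open import Relation.Nullary.Decidable using (⌊_⌋)
open import Function.Bundles using (_⇔_)

record Hypergraph (r n : ℕ) : Set where
  field
    edges   : List (Subset n)
    unique  : Unique edges
    uniform : All (λ e → ∣ e ∣ ≡ r) edges
open Hypergraph public

_∈E_ : ∀ {r n} → Subset n → Hypergraph r n → Set
e ∈E H = e ∈ₗ edges H

degree : ∀ {r n} → Hypergraph r n → Fin n → ℕ
degree H v = length (filter (v ∈?_) (edges H))

-- H ∈ F^(r)(n,Δ)  iff  MaxDegreeAtMost H Δ
MaxDegreeAtMost : ∀ {r n} → Hypergraph r n → ℕ → Set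
MaxDegreeAtMost H Δ = ∀ v → degree H v ≤ Δ

Nbr : ∀ {r n} → Hypergraph r n → Fin n → Fin n → Set
Nbr H v w = w ≢ v × ∃ λ e → e ∈E H × v ∈ e × w ∈ e

Image : ∀ {n n'} → (Fin n → Fin n') → (Fin n → Set) → (Fin n' → Set) → Set
Image {n} f A B = ∀ y → B y ⇔ (∃ λ (x : Fin n) → A x × f x ≡ y)

-- Equivalence of the profiles P_H(v) and P_H'(v'):
-- f restricted to N_H(v) is a bijection onto N_H'(v') with inverse g, which is
-- an isomorphism of H[N_H(v)] onto H'[N_H'(v')] and of the links.
-- (link_H(v) = { e \ {v} : e ∈ E(H), v ∈ e }.)
record ProfileEquiv {r n n'} (H : Hypergraph r n) (v : Fin n)
                    (H' : Hypergraph r n') (v' : Fin n') : Set where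
  field
    f      : Fin n → Fin n'
    g      : Fin n' → Fin n
    f-nbr  : ∀ w → Nbr H v w → Nbr H' v' (f w)
    g-nbr  : ∀ w' → Nbr H' v' w' → Nbr H v (g w')
    gf     : ∀ w → Nbr H v w → g (f w) ≡ w
    fg     : ∀ w' → Nbr H' v' w' → f (g w') ≡ w'
    ind-f  : ∀ e → e ∈E H → (∀ w → w ∈ e → Nbr H v w) →
             ∃ λ e' → e' ∈E H' × Image f (λ w → w ∈ e) (λ w' → w' ∈ e')
    ind-g  : ∀ e' → e' ∈E H' → (∀ w' → w' ∈ e' → Nbr H' v' w') →
             ∃ λ e → e ∈E H × Image g (λ w' → w' ∈ e') (λ w → w ∈ e)
    link-f : ∀ e → e ∈E H → v ∈ e →
             ∃ λ e' → e' ∈E H' × v' ∈ e' ×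
               Image f (λ w → w ∈ e × w ≢ v) (λ w' → w' ∈ e' × w' ≢ v')
    link-g : ∀ e' → e' ∈E H' → v' ∈ e' →
             ∃ λ e → e ∈E H × v ∈ e ×
               Image g (λ w' → w' ∈ e' × w' ≢ v') (λ w → w ∈ e × w ≢ v)

-- a vertex of some hypergraph in ⋃_n F^(r)(n,Δ)
record Pointed (r Δ : ℕ) : Set where
  field
    nV      : ℕ
    graph   : Hypergraph r nV
    bounded : MaxDegreeAtMost graph Δ
    vertex  : Fin nV
open Pointed public

PEquiv : ∀ {r Δ} → Pointed r Δ → Pointed r Δ → Set
PEquiv a b = ProfileEquiv (graph a) (vertex a) (graph b) (vertex b)

-- |P^(r)(Δ)| = p : there are p representatives, every profile is equivalent to
-- one of them, and distinct representatives are inequivalent.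
ProfileClassCount : ℕ → ℕ → ℕ → Set
ProfileClassCount r Δ p =
  Σ (Fin p → Pointed r Δ) λ rep →
    (∀ (a : Pointed r Δ) → ∃ λ i → PEquiv a (rep i)) ×
    (∀ i j → PEquiv (rep i) (rep j) → i ≡ j)

data Path {r n} (H : Hypergraph r n) : Fin n → Fin n → ℕ → Set where
  here : ∀ {u} → Path H u u zero
  step : ∀ {u w x s} (e : Subset n) → e ∈E H → u ∈ e → w ∈ e →
         Path H w x s → Path H u x (suc s)

-- distance ≥ 4 for distinct vertices of W
ThreeIndependent : ∀ {r n} → Hypergraph r n → (Fin n → Set) → Set
ThreeIndependent H W =
  ∀ u w → W u → W w → u ≢ w → ∀ s → s < 4 → ¬ Path H u w s

classSize : ∀ {n k} → (Fin n → Fin k) → Fin k → ℕ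
classSize col i = ∣ tabulate (λ v → ⌊ col v ≟ i ⌋) ∣

tParam : ℕ → ℕ → ℕ
tParam r Δ = r ^ 3 * Δ ^ 3

module Submission where

-- Call two distinct vertices close if a path of length at most 3 joins them, so
-- a set is 3-independent iff no two of its vertices are close.  Every vertex v
-- has at most B = Δ(r-1)·(Δr)² close vertices, all listed in a "ball" built by
-- walking along edges from v, and B + 2 ≤ t = r³Δ³.  Hence a greedy colouring
-- colours the closeness relation properly with t - 1 colours.  Combining the
-- colour of a vertex with its profile class gives p(t - 1) classes, and since
-- m·p(t - 1) ≤ n the pigeonhole principle yields m vertices agreeing in both:
-- they form X_t (3-independent with equivalent profiles), X_0 is their
-- neighbourhood, and each remaining vertex goes to the part given by its colour.

open import Defs
open import Data.Bool using (Bool; true; false)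
open import Data.Bool.Properties using (¬-not)
open import Data.Fin using (Fin; fromℕ; toℕ; inject₁; combine; _≟_) renaming (zero to fzero; suc to fsuc)
open import Data.Fin.Properties using (any?; injective⇒≤; suc-injective; inject₁-injective; fromℕ≢inject₁; combine-injective)
open import Data.Fin.Subset using (Subset; ∣_∣; _⊆_; ⊥; inside; outside) renaming (_∈_ to _∈ₛ_; _∉_ to _∉ₛ_)
open import Data.Fin.Subset.Properties using (⊥⊆; ∣⊥∣≡0; out⊆; in⊆in) renaming (_∈?_ to _∈ₛ?_)
open import Data.List using (List; []; _∷_; length; map; filter; concatMap; _++_; allFin)
import Data.List as List
open import Data.List.Properties using (length-++; length-map; length-filter; filter-notAll)
open import Data.List.Membership.Propositional using (_∈_; _∉_; find; lose)
open import Data.List.Membership.Propositional.Properties using (∈-map⁺; ∈-filter⁺; ∈-filter⁻; ∈-concatMap⁺; ∈-allFin)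
open import Data.List.Relation.Unary.All using ([])
import Data.List.Relation.Unary.All as All
open import Data.List.Relation.Unary.AllPairs using ([]; _∷_)
open import Data.List.Relation.Unary.Any using (here; there; index)
import Data.List.Relation.Unary.Any as Any
open import Data.List.Relation.Unary.Any.Properties using (lookup-index)
open import Data.List.Relation.Unary.Unique.Propositional using (Unique)
open import Data.List.Relation.Unary.Unique.Propositional.Properties using (allFin⁺)
open import Data.Nat using (ℕ; zero; suc; _+_; _*_; _∸_; _≤_; _<_; _≤?_; z≤n; s≤s)
open import Data.Nat.Properties
  using ( +-0-commutativeMonoid; ≤-trans; ≤-reflexive; <⇒≤; <⇒≱; ≰⇒>; ≤-pred; m≤n⇒m≤1+n
        ; +-mono-≤; +-monoˡ-≤; +-cancelˡ-≤; *-mono-≤; ∸-monoˡ-≤; *-suc; *-identityʳ; +-identityʳ)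
open import Data.Nat.Tactic.RingSolver using (solve-∀)
open import Algebra.Properties.CommutativeMonoid.Sum +-0-commutativeMonoid
  using (sum-syntax; sum-cong-≗; sum-replicate-zero; ∑-distrib-+)
open import Data.Product using (Σ; ∃; _×_; _,_; proj₁; proj₂)
open import Data.Vec using ([]; _∷_; here; there; tabulate; lookup)
open import Data.Vec.Properties using (lookup∘tabulate; tabulate∘lookup; tabulate-cong; []=⇒lookup; lookup⇒[]=)
open import Data.Vec.Functional using (updateAt)
open import Data.Vec.Functional.Properties using (updateAt-updates; updateAt-minimal)
open import Function using (_∘_)
open import Function.Bundles using (_⇔_; mk⇔; Equivalence)
open import Relation.Binary.PropositionalEquality using (_≡_; _≢_; refl; sym; trans; cong; cong₂; subst; module ≡-Reasoning)
open import Relation.Nullary using (¬_; Dec; yes; no; ¬?)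
open import Relation.Nullary.Decidable using (⌊_⌋; decidable-stable; _×-dec_; map′; dec-true; dec-false; isYes≗does; ⌊⌋-map′)
open import Relation.Nullary.Negation using (contradiction)

𝟙 : Bool → ℕ
𝟙 true  = 1
𝟙 false = 0

∣∷∣ : ∀ {n} b (p : Subset n) → ∣ b ∷ p ∣ ≡ 𝟙 b + ∣ p ∣
∣∷∣ true  p = refl
∣∷∣ false p = refl

∑-indicator : ∀ {q} (x : Fin q) → ∑[ c < q ] 𝟙 ⌊ x ≟ c ⌋ ≡ 1
∑-indicator {suc q} fzero    = cong suc (sum-replicate-zero q)
∑-indicator {suc q} (fsuc x) =
  trans (sum-cong-≗ (λ c → cong 𝟙 (⌊⌋-map′ (cong fsuc) suc-injective (x ≟ c)))) (∑-indicator x)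

∑-classSize : ∀ {n q} (f : Fin n → Fin q) → ∑[ c < q ] classSize f c ≡ n
∑-classSize {zero}  {q} f = sum-replicate-zero q
∑-classSize {suc n} {q} f = begin
  ∑[ c < q ] classSize f c
    ≡⟨ sum-cong-≗ (λ c → ∣∷∣ ⌊ f fzero ≟ c ⌋ (tabulate (λ v → ⌊ f (fsuc v) ≟ c ⌋))) ⟩
  ∑[ c < q ] (𝟙 ⌊ f fzero ≟ c ⌋ + classSize (f ∘ fsuc) c)
    ≡⟨ ∑-distrib-+ (λ c → 𝟙 ⌊ f fzero ≟ c ⌋) (classSize (f ∘ fsuc)) ⟩
  ∑[ c < q ] 𝟙 ⌊ f fzero ≟ c ⌋ + ∑[ c < q ] classSize (f ∘ fsuc) c
    ≡⟨ cong₂ _+_ (∑-indicator (f fzero)) (∑-classSize (f ∘ fsuc)) ⟩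
  suc n ∎
  where open ≡-Reasoning

∑-pigeonhole : ∀ {q} m (a : Fin (suc q) → ℕ) → m * suc q ≤ ∑[ c < suc q ] a c →
               ∃ λ c → m ≤ a c
∑-pigeonhole {q} m a m*q≤∑ with m ≤? a fzero
... | yes m≤a₀ = fzero , m≤a₀
∑-pigeonhole {zero} m a m*1≤∑ | no m≰a₀ =
  contradiction (≤-trans (≤-reflexive (sym (*-identityʳ m)))
                         (≤-trans m*1≤∑ (≤-reflexive (+-identityʳ _)))) m≰a₀
∑-pigeonhole {suc q} m a m*q≤∑ | no m≰a₀ with ∑-pigeonhole m (a ∘ fsuc) rest
  where
  rest : m * suc q ≤ ∑[ c < suc q ] a (fsuc c)
  rest = +-cancelˡ-≤ m _ _ (≤-trans (≤-reflexive (sym (*-suc m (suc q))))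
           (≤-trans m*q≤∑ (+-monoˡ-≤ _ (<⇒≤ (≰⇒> m≰a₀)))))
... | c , m≤a = fsuc c , m≤a

subsetOfSize : ∀ {n} m (p : Subset n) → m ≤ ∣ p ∣ → ∃ λ q → q ⊆ p × ∣ q ∣ ≡ m
subsetOfSize {n} zero p _ = ⊥ , ⊥⊆ , ∣⊥∣≡0 n
subsetOfSize (suc m) (inside ∷ p) (s≤s m≤p) with subsetOfSize m p m≤p
... | q , q⊆p , ∣q∣≡m = inside ∷ q , in⊆in q⊆p , cong suc ∣q∣≡m
subsetOfSize (suc m) (outside ∷ p) m<p with subsetOfSize (suc m) p m<p
... | q , q⊆p , ∣q∣≡m = outside ∷ q , out⊆ q⊆p , ∣q∣≡m

∈-class : ∀ {n k} {f : Fin n → Fin k} {c v} → v ∈ₛ tabulate (λ u → ⌊ f u ≟ c ⌋) → f v ≡ c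
∈-class {f = f} {c} {v} v∈class = witness (trans (sym (lookup∘tabulate _ v)) ([]=⇒lookup v∈class))
  where
  witness : ⌊ f v ≟ c ⌋ ≡ true → f v ≡ c
  witness with f v ≟ c
  ... | yes fv≡c = λ _ → fv≡c
  ... | no  _    = λ ()

homogeneousSet : ∀ {n q} m (f : Fin n → Fin (suc q)) → m * suc q ≤ n →
                 ∃ λ X → ∣ X ∣ ≡ m × (∀ {x y} → x ∈ₛ X → y ∈ₛ X → f x ≡ f y)
homogeneousSet m f m*q≤n
  with ∑-pigeonhole m (classSize f) (subst (m * _ ≤_) (sym (∑-classSize f)) m*q≤n)
... | c , m≤∣class∣ with subsetOfSize m (tabulate (λ v → ⌊ f v ≟ c ⌋)) m≤∣class∣
...   | X , X⊆class , ∣X∣≡m = X , ∣X∣≡m , λ x∈X y∈X → trans (inClass x∈X) (sym (inClass y∈X))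
  where
  inClass : ∀ {x} → x ∈ₛ X → f x ≡ c
  inClass x∈X = ∈-class {f = f} (X⊆class x∈X)

_∈?_ : ∀ {n} (x : Fin n) (xs : List (Fin n)) → Dec (x ∈ xs)
x ∈? xs = Any.any? (x ≟_) xs

length-cover : ∀ {n} (xs : List (Fin n)) → (∀ x → x ∈ xs) → n ≤ length xs
length-cover xs covers = injective⇒≤ position-injective
  where
  position-injective : ∀ {x y} → index (covers x) ≡ index (covers y) → x ≡ y
  position-injective {x} {y} eq =
    trans (lookup-index (covers x)) (trans (cong (List.lookup xs) eq) (sym (lookup-index (covers y))))

unusedColour : ∀ {K} (cs : List (Fin (suc K))) → length cs ≤ K → ∃ λ c → c ∉ cs
unusedColour cs ∣cs∣≤K with any? (λ c → ¬? (c ∈? cs))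
... | yes free = free
... | no  none = contradiction (length-cover cs everyColourUsed) (<⇒≱ (s≤s ∣cs∣≤K))
  where
  everyColourUsed : ∀ c → c ∈ cs
  everyColourUsed c = decidable-stable (c ∈? cs) (λ c∉cs → none (c , c∉cs))

Proper : ∀ {n k} → (Fin n → Fin n → Set) → (Fin n → Fin k) → Set
Proper _~_ h = ∀ {u w} → u ~ w → h u ≢ h w

-- Vertices are coloured one at a time, each
-- with a colour unused by its already coloured neighbours.
module GreedyColouring {n K : ℕ} (_~_ : Fin n → Fin n → Set)
    (~-sym : ∀ {u w} → u ~ w → w ~ u) (~-irrefl : ∀ {u} → ¬ u ~ u)
    (N : Fin n → List (Fin n)) (N-complete : ∀ {u w} → u ~ w → w ∈ N u)
    (N-bound : ∀ u → length (N u) ≤ K) where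

  ProperOn : (Fin n → Fin (suc K)) → List (Fin n) → Set
  ProperOn h D = ∀ {u w} → u ∈ D → w ∈ D → u ~ w → h u ≢ h w

  freshColour : (h : Fin n → Fin (suc K)) (D : List (Fin n)) (v : Fin n) →
                ∃ λ c → ∀ {w} → w ∈ D → v ~ w → c ≢ h w
  freshColour h D v with unusedColour (map h (filter (_∈? D) (N v))) used≤K
    where
    used≤K : length (map h (filter (_∈? D) (N v))) ≤ K
    used≤K = ≤-trans (≤-reflexive (length-map h (filter (_∈? D) (N v))))
                     (≤-trans (length-filter (_∈? D) (N v)) (N-bound v))
  ... | c , c-unused = c , λ w∈D v~w c≡hw →
    c-unused (subst (_∈ _) (sym c≡hw) (∈-map⁺ h (∈-filter⁺ (_∈? D) (N-complete v~w) w∈D)))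

  colourList : (D : List (Fin n)) → Unique D → Σ (Fin n → Fin (suc K)) λ h → ProperOn h D
  colourList []      _             = (λ _ → fzero) , λ ()
  colourList (v ∷ D) (v∉D ∷ D-uniq) with colourList D D-uniq
  ... | h , proper with freshColour h D v
  ...   | c , c-fresh = h' , proper'
    where
    h' : Fin n → Fin (suc K)
    h' = updateAt h v (λ _ → c)
    h'-v : h' v ≡ c
    h'-v = updateAt-updates v h
    h'-D : ∀ {w} → w ∈ D → h' w ≡ h w
    h'-D w∈D = updateAt-minimal _ v h (λ w≡v → All.lookup v∉D w∈D (sym w≡v))
    proper' : ProperOn h' (v ∷ D)
    proper' (here refl) (here refl) v~v = contradiction v~v ~-irrefl
    proper' (here refl) (there w∈D) v~w eq = c-fresh w∈D v~w (trans (sym h'-v) (trans eq (h'-D w∈D)))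
    proper' (there u∈D) (here refl) u~v eq =
      c-fresh u∈D (~-sym u~v) (trans (sym h'-v) (trans (sym eq) (h'-D u∈D)))
    proper' (there u∈D) (there w∈D) u~w eq =
      proper u∈D w∈D u~w (trans (sym (h'-D u∈D)) (trans eq (h'-D w∈D)))

  colouring : Σ (Fin n → Fin (suc K)) (Proper _~_)
  colouring with colourList (allFin n) (allFin⁺ n)
  ... | h , proper = h , λ u~w → proper (∈-allFin _) (∈-allFin _) u~w

length-concatMap≤ : ∀ {A B : Set} (f : A → List B) (xs : List A) {a b} → length xs ≤ a →
                    (∀ {x} → x ∈ xs → length (f x) ≤ b) → length (concatMap f xs) ≤ a * b
length-concatMap≤ f [] _ _ = z≤n
length-concatMap≤ f (x ∷ xs) {suc a} {b} (s≤s ∣xs∣≤a) ∣f∣≤b = begin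
  length (f x ++ concatMap f xs)          ≡⟨ length-++ (f x) ⟩
  length (f x) + length (concatMap f xs)  ≤⟨ +-mono-≤ (∣f∣≤b (here refl))
                                                       (length-concatMap≤ f xs ∣xs∣≤a (∣f∣≤b ∘ there)) ⟩
  b + a * b                               ∎
  where
  open Data.Nat.Properties.≤-Reasoning

members : ∀ {n} → Subset n → List (Fin n)
members []            = []
members (true  ∷ p) = fzero ∷ map fsuc (members p)
members (false ∷ p) = map fsuc (members p)

length-members : ∀ {n} (p : Subset n) → length (members p) ≡ ∣ p ∣
length-members []            = refl
length-members (true  ∷ p) = cong suc (trans (length-map fsuc (members p)) (length-members p))
length-members (false ∷ p) = trans (length-map fsuc (members p)) (length-members p)

∈-members : ∀ {n} {x : Fin n} {p} → x ∈ₛ p → x ∈ members p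
∈-members here                       = here refl
∈-members {p = true  ∷ p} (there x∈p) = there (∈-map⁺ fsuc (∈-members x∈p))
∈-members {p = false ∷ p} (there x∈p) = ∈-map⁺ fsuc (∈-members x∈p)

Close : ∀ {r n} → Hypergraph r n → Fin n → Fin n → Set
Close F u w = u ≢ w × ∃ λ s → s < 4 × Path F u w s

-- The bound Δ(r-1)(Δr)² on the number of vertices close to a given vertex:
-- a first step to one of Δ(r-1) other vertices, then two steps of Δr choices.
ballBound : ℕ → ℕ → ℕ
ballBound r Δ = Δ * (r ∸ 1) * (Δ * r * (Δ * r))

module Neighbourhoods {r n : ℕ} (F : Hypergraph r n) where

  -- Paths can be extended at their end and hence traversed backwards, so
  -- closeness is symmetric.
  snoc : ∀ {u w x s} → Path F u w s → (e : Subset n) → e ∈E F → w ∈ₛ e → x ∈ₛ e → Path F u x (suc s)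
  snoc here                   e e∈F w∈e x∈e = step e e∈F w∈e x∈e here
  snoc (step e' e'∈F u∈e' v∈e' p) e e∈F w∈e x∈e = step e' e'∈F u∈e' v∈e' (snoc p e e∈F w∈e x∈e)

  reverse : ∀ {u w s} → Path F u w s → Path F w u s
  reverse here                   = here
  reverse (step e e∈F u∈e v∈e p) = snoc (reverse p) e e∈F v∈e u∈e

  close-sym : ∀ {u w} → Close F u w → Close F w u
  close-sym (u≢w , s , s<4 , p) = (λ w≡u → u≢w (sym w≡u)) , s , s<4 , reverse p

  incident : Fin n → List (Subset n)
  incident v = filter (v ∈ₛ?_) (edges F)

  adj : Fin n → List (Fin n)
  adj v = concatMap members (incident v)

  adj⁻ : Fin n → List (Fin n)
  adj⁻ v = concatMap (λ e → filter (λ w → ¬? (w ≟ v)) (members e)) (incident v)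

  ball : Fin n → List (Fin n)
  ball v = concatMap (λ w → concatMap adj (adj w)) (adj⁻ v)

  adj-complete : ∀ {e x y} → e ∈E F → x ∈ₛ e → y ∈ₛ e → y ∈ adj x
  adj-complete {x = x} e∈F x∈e y∈e =
    ∈-concatMap⁺ members (lose (∈-filter⁺ (x ∈ₛ?_) e∈F x∈e) (∈-members y∈e))

  adj²-complete : ∀ {e x w s} → e ∈E F → x ∈ₛ e → Path F x w s → s ≤ 2 → w ∈ concatMap adj (adj x)
  adj²-complete e∈F x∈e here _ =
    ∈-concatMap⁺ adj (lose (adj-complete e∈F x∈e x∈e) (adj-complete e∈F x∈e x∈e))
  adj²-complete _ _ (step e e∈F x∈e y∈e here) _ =
    ∈-concatMap⁺ adj (lose (adj-complete e∈F x∈e y∈e) (adj-complete e∈F y∈e y∈e))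
  adj²-complete _ _ (step e e∈F x∈e y∈e (step e' e'∈F y∈e' z∈e' here)) _ =
    ∈-concatMap⁺ adj (lose (adj-complete e∈F x∈e y∈e) (adj-complete e'∈F y∈e' z∈e'))
  adj²-complete _ _ (step _ _ _ _ (step _ _ _ _ (step _ _ _ _ _))) (s≤s (s≤s ()))

  -- Every vertex close to u lies in ball u.  A path that begins by staying at u
  -- is shortened; otherwise its first step leaves u to a vertex of adj⁻ u.
  ball-complete : ∀ {u w s} → u ≢ w → s < 4 → Path F u w s → w ∈ ball u
  ball-complete u≢u _ here = contradiction refl u≢u
  ball-complete {u} u≢w s+1<4 (step {w = w₁} e e∈F u∈e w₁∈e p) with w₁ ≟ u
  ... | yes refl = ball-complete u≢w (m≤n⇒m≤1+n (≤-pred s+1<4)) p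
  ... | no w₁≢u  =
    ∈-concatMap⁺ _ (lose w₁∈adj⁻u (adj²-complete e∈F w₁∈e p (≤-pred (≤-pred s+1<4))))
    where
    w₁∈adj⁻u : w₁ ∈ adj⁻ u
    w₁∈adj⁻u = ∈-concatMap⁺ _ (lose (∈-filter⁺ (u ∈ₛ?_) e∈F u∈e)
                                     (∈-filter⁺ (λ w → ¬? (w ≟ u)) (∈-members w₁∈e) w₁≢u))

  module _ {Δ : ℕ} (bounded : MaxDegreeAtMost F Δ) where

    members-length : ∀ {v e} → e ∈ incident v → length (members e) ≤ r
    members-length {v} {e} e∈inc =
      ≤-reflexive (trans (length-members e) (All.lookup (uniform F) (proj₁ (∈-filter⁻ (v ∈ₛ?_) e∈inc))))

    adj-length : ∀ v → length (adj v) ≤ Δ * r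
    adj-length v = length-concatMap≤ members (incident v) (bounded v) members-length

    -- v lies on each of its edges, so removing it leaves at most r - 1 vertices.
    adj⁻-length : ∀ v → length (adj⁻ v) ≤ Δ * (r ∸ 1)
    adj⁻-length v = length-concatMap≤ _ (incident v) (bounded v) others-length
      where
      others-length : ∀ {e} → e ∈ incident v → length (filter (λ w → ¬? (w ≟ v)) (members e)) ≤ r ∸ 1
      others-length {e} e∈inc = ∸-monoˡ-≤ 1 (≤-trans (filter-notAll (λ w → ¬? (w ≟ v)) (members e) v∈e)
                                                    (members-length e∈inc))
        where
        v∈e : Any.Any (λ w → ¬ (w ≢ v)) (members e)
        v∈e = Any.map (λ v≡w w≢v → w≢v (sym v≡w))
                      (∈-members (proj₂ (∈-filter⁻ (v ∈ₛ?_) {xs = edges F} e∈inc)))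

    ball-length : ∀ v → length (ball v) ≤ ballBound r Δ
    ball-length v = length-concatMap≤ _ (adj⁻ v) (adj⁻-length v)
                      (λ {w} _ → length-concatMap≤ adj (adj w) (adj-length w) (λ {x} _ → adj-length x))

-- r³Δ³ = Δ(Δr)² + Δ(r-1)(Δr)² for r = 1 + a (powers written out for the ring solver).
tParam-split : ∀ a Δ → ((1 + a) * ((1 + a) * ((1 + a) * 1))) * (Δ * (Δ * (Δ * 1))) ≡
                       Δ * (Δ * (1 + a) * (Δ * (1 + a))) + Δ * a * (Δ * (1 + a) * (Δ * (1 + a)))
tParam-split = solve-∀

ballBound+2≤tParam : ∀ {r Δ} → 2 ≤ r → 1 ≤ Δ → 2 + ballBound r Δ ≤ tParam r Δ
ballBound+2≤tParam {suc a} {Δ} 2≤r 1≤Δ = begin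
  2 + ballBound (suc a) Δ                              ≤⟨ +-monoˡ-≤ (ballBound (suc a) Δ) 2≤Δ[Δr]² ⟩
  Δ * (Δ * suc a * (Δ * suc a)) + ballBound (suc a) Δ ≡⟨ sym (tParam-split a Δ) ⟩
  tParam (suc a) Δ                                     ∎
  where
  open Data.Nat.Properties.≤-Reasoning
  2≤Δr : 2 ≤ Δ * suc a
  2≤Δr = *-mono-≤ 1≤Δ 2≤r
  2≤Δ[Δr]² : 2 ≤ Δ * (Δ * suc a * (Δ * suc a))
  2≤Δ[Δr]² = ≤-trans (s≤s (s≤s z≤n)) (*-mono-≤ 1≤Δ (*-mono-≤ 2≤Δr 2≤Δr))

distanceColouring : ∀ {r n Δ} (F : Hypergraph r n) → MaxDegreeAtMost F Δ →
                    ∀ K → ballBound r Δ ≤ K → Σ (Fin n → Fin (suc K)) (Proper (Close F))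
distanceColouring F bounded K B≤K = GreedyColouring.colouring (Close F) close-sym
  (λ (u≢u , _) → u≢u refl) ball (λ (u≢w , _ , s<4 , p) → ball-complete u≢w s<4 p)
  (λ v → ≤-trans (ball-length bounded v) B≤K)
  where open Neighbourhoods F

image-∘ : ∀ {n₁ n₂ n₃} {f : Fin n₁ → Fin n₂} {g : Fin n₂ → Fin n₃} {A B C} →
          Image f A B → Image g B C → Image (g ∘ f) A C
image-∘ {f = f} {g} {A} {B} {C} f[A]≡B g[B]≡C z = mk⇔ to from
  where
  to : C z → ∃ λ x → A x × g (f x) ≡ z
  to Cz with Equivalence.to (g[B]≡C z) Cz
  ... | y , By , refl with Equivalence.to (f[A]≡B y) By
  ... | x , Ax , refl = x , Ax , refl
  from : (∃ λ x → A x × g (f x) ≡ z) → C z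
  from (x , Ax , refl) = Equivalence.from (g[B]≡C z) (f x , Equivalence.from (f[A]≡B (f x)) (x , Ax , refl) , refl)

image-⊆ : ∀ {n n'} {f : Fin n → Fin n'} {A B} {P : Fin n' → Set} →
          Image f A B → (∀ x → A x → P (f x)) → ∀ y → B y → P y
image-⊆ f[A]≡B A⇒P y By with Equivalence.to (f[A]≡B y) By
... | x , Ax , refl = A⇒P x Ax

profileEquiv-sym : ∀ {r n₁ n₂} {H₁ : Hypergraph r n₁} {v₁} {H₂ : Hypergraph r n₂} {v₂} →
                   ProfileEquiv H₁ v₁ H₂ v₂ → ProfileEquiv H₂ v₂ H₁ v₁
profileEquiv-sym P = record
  { f = g ; g = f ; f-nbr = g-nbr ; g-nbr = f-nbr ; gf = fg ; fg = gf
  ; ind-f = ind-g ; ind-g = ind-f ; link-f = link-g ; link-g = link-f }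
  where open ProfileEquiv P

profileEquiv-trans : ∀ {r n₁ n₂ n₃} {H₁ : Hypergraph r n₁} {v₁} {H₂ : Hypergraph r n₂} {v₂}
                       {H₃ : Hypergraph r n₃} {v₃} →
                     ProfileEquiv H₁ v₁ H₂ v₂ → ProfileEquiv H₂ v₂ H₃ v₃ → ProfileEquiv H₁ v₁ H₃ v₃
profileEquiv-trans P Q = record
  { f      = Q.f ∘ P.f
  ; g      = P.g ∘ Q.g
  ; f-nbr  = λ w w~v₁ → Q.f-nbr _ (P.f-nbr w w~v₁)
  ; g-nbr  = λ w w~v₃ → P.g-nbr _ (Q.g-nbr w w~v₃)
  ; gf     = λ w w~v₁ → trans (cong P.g (Q.gf _ (P.f-nbr w w~v₁))) (P.gf w w~v₁)
  ; fg     = λ w w~v₃ → trans (cong Q.f (P.fg _ (Q.g-nbr w w~v₃))) (Q.fg w w~v₃)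
  ; ind-f  = λ e e∈H₁ e⊆N →
      let e' , e'∈H₂ , P[e]≡e' = P.ind-f e e∈H₁ e⊆N
          e'' , e''∈H₃ , Q[e']≡e'' =
            Q.ind-f e' e'∈H₂ (image-⊆ P[e]≡e' (λ w w∈e → P.f-nbr w (e⊆N w w∈e)))
      in e'' , e''∈H₃ , image-∘ P[e]≡e' Q[e']≡e''
  ; ind-g  = λ e e∈H₃ e⊆N →
      let e' , e'∈H₂ , Q[e]≡e' = Q.ind-g e e∈H₃ e⊆N
          e'' , e''∈H₁ , P[e']≡e'' =
            P.ind-g e' e'∈H₂ (image-⊆ Q[e]≡e' (λ w w∈e → Q.g-nbr w (e⊆N w w∈e)))
      in e'' , e''∈H₁ , image-∘ Q[e]≡e' P[e']≡e''
  ; link-f = λ e e∈H₁ v₁∈e →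
      let e' , e'∈H₂ , v₂∈e' , P[e]≡e' = P.link-f e e∈H₁ v₁∈e
          e'' , e''∈H₃ , v₃∈e'' , Q[e']≡e'' = Q.link-f e' e'∈H₂ v₂∈e'
      in e'' , e''∈H₃ , v₃∈e'' , image-∘ P[e]≡e' Q[e']≡e''
  ; link-g = λ e e∈H₃ v₃∈e →
      let e' , e'∈H₂ , v₂∈e' , Q[e]≡e' = Q.link-g e e∈H₃ v₃∈e
          e'' , e''∈H₁ , v₁∈e'' , P[e']≡e'' = P.link-g e' e'∈H₂ v₂∈e'
      in e'' , e''∈H₁ , v₁∈e'' , image-∘ Q[e]≡e' P[e']≡e''
  }
  where
  module P = ProfileEquiv P
  module Q = ProfileEquiv Q

-- There is at least one profile class: the single vertex of the edgeless
-- one-vertex hypergraph has a profile.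
noProfileClasses : ∀ {r Δ} → ¬ ProfileClassCount r Δ 0
noProfileClasses {r} {Δ} (_ , classify , _) with proj₁ (classify isolatedVertex)
  where
  isolatedVertex : Pointed r Δ
  isolatedVertex = record
    { nV = 1 ; graph = record { edges = [] ; unique = [] ; uniform = [] }
    ; bounded = λ _ → z≤n ; vertex = fzero }
... | ()

Partition : ∀ {r n} → Hypergraph r n → ℕ → ℕ → Set
Partition {n = n} F T m =
  ∃ λ (col : Fin n → Fin (suc T)) →
    (classSize col (fromℕ T) ≡ m) ×
    (∀ v → (col v ≡ fzero) ⇔ (∃ λ x → (col x ≡ fromℕ T) × Nbr F x v)) ×
    (∀ x y → col x ≡ fromℕ T → col y ≡ fromℕ T → ProfileEquiv F x F y) ×
    (∀ (i : Fin (suc T)) → 1 ≤ toℕ i → ThreeIndependent F (λ v → col v ≡ i))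

module Assembly {r n K : ℕ} (F : Hypergraph r n)
    (h : Fin n → Fin (suc K)) (h-proper : Proper (Close F) h) (X : Subset n)
    (X-independent : ∀ {x y} → x ∈ₛ X → y ∈ₛ X → ¬ Close F x y)
    (X-profiles : ∀ {x y} → x ∈ₛ X → y ∈ₛ X → ProfileEquiv F x F y) where

  top : Fin (suc (suc (suc K)))
  top = fromℕ (suc (suc K))

  Touches : Fin n → Set
  Touches v = ∃ λ x → x ∈ₛ X × Nbr F x v

  nbr? : ∀ x v → Dec (Nbr F x v)
  nbr? x v = ¬? (v ≟ x) ×-dec map′ find (λ (_ , e∈F , x∈e,v∈e) → lose e∈F x∈e,v∈e)
                                    (Any.any? (λ e → (x ∈ₛ? e) ×-dec (v ∈ₛ? e)) (edges F))

  touches? : ∀ v → Dec (Touches v)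
  touches? v = any? (λ x → (x ∈ₛ? X) ×-dec nbr? x v)

  touches⇒∉ : ∀ {v} → Touches v → v ∉ₛ X
  touches⇒∉ (x , x∈X , v≢x , e , e∈F , x∈e , v∈e) v∈X =
    X-independent x∈X v∈X ((λ x≡v → v≢x (sym x≡v)) , 1 , s≤s (s≤s z≤n) , step e e∈F x∈e v∈e here)

  part : Fin n → Fin (suc (suc (suc K)))
  part v with v ∈ₛ? X | touches? v
  ... | yes _ | _     = top
  ... | no  _ | yes _ = fzero
  ... | no  _ | no  _ = fsuc (inject₁ (h v))

  data PartView (v : Fin n) : Fin (suc (suc (suc K))) → Set where
    centre : v ∈ₛ X → PartView v top
    shell  : v ∉ₛ X → Touches v → PartView v fzero
    outer  : v ∉ₛ X → ¬ Touches v → PartView v (fsuc (inject₁ (h v)))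

  view : ∀ v → PartView v (part v)
  view v with v ∈ₛ? X | touches? v
  ... | yes v∈X | _         = centre v∈X
  ... | no  v∉X | yes t     = shell v∉X t
  ... | no  v∉X | no  ¬t    = outer v∉X ¬t

  outer≢top : ∀ c → fsuc (inject₁ c) ≢ top
  outer≢top c eq = fromℕ≢inject₁ (sym (suc-injective eq))

  top⇒centre : ∀ {v i} → PartView v i → i ≡ top → v ∈ₛ X
  top⇒centre (centre v∈X)  _  = v∈X
  top⇒centre (shell _ _)   ()
  top⇒centre (outer _ _)   eq = contradiction eq (outer≢top _)

  centre⇒top : ∀ {v i} → PartView v i → v ∈ₛ X → i ≡ top
  centre⇒top (centre _)    _   = refl
  centre⇒top (shell v∉X _) v∈X = contradiction v∈X v∉X
  centre⇒top (outer v∉X _) v∈X = contradiction v∈X v∉X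

  zero⇔touches : ∀ {v i} → PartView v i → (i ≡ fzero) ⇔ Touches v
  zero⇔touches (centre v∈X)   = mk⇔ (λ ()) (λ t → contradiction v∈X (touches⇒∉ t))
  zero⇔touches (shell _ t)    = mk⇔ (λ _ → t) (λ _ → refl)
  zero⇔touches (outer _ ¬t)   = mk⇔ (λ ()) (λ t → contradiction t ¬t)

  -- Two close vertices never share a nonzero part: inside X by independence,
  -- outside X and its neighbourhood because h is proper.
  separated : ∀ {u w i j} → PartView u i → PartView w j → i ≡ j → i ≢ fzero → ¬ Close F u w
  separated (centre u∈X) w-view      refl _   = X-independent u∈X (top⇒centre w-view refl)
  separated (shell _ _)  _           _    i≢0 = contradiction refl i≢0
  separated (outer _ _)  (centre _)  eq   _   = contradiction eq (outer≢top _)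
  separated (outer _ _)  (shell _ _) ()   _
  separated (outer _ _)  (outer _ _) eq   _   = λ u~w → h-proper u~w (inject₁-injective (suc-injective eq))

  size : classSize part top ≡ ∣ X ∣
  size = trans (cong ∣_∣ (tabulate-cong indicator)) (cong ∣_∣ (tabulate∘lookup X))
    where
    indicator : ∀ v → ⌊ part v ≟ top ⌋ ≡ lookup X v
    indicator v = byMembership (v ∈ₛ? X)
      where
      isTop : Dec (part v ≡ top)
      isTop = part v ≟ top
      byMembership : Dec (v ∈ₛ X) → ⌊ isTop ⌋ ≡ lookup X v
      byMembership (yes v∈X) = trans (trans (isYes≗does isTop) (dec-true isTop (centre⇒top (view v) v∈X)))
                                     (sym ([]=⇒lookup v∈X))
      byMembership (no  v∉X) = trans (trans (isYes≗does isTop) (dec-false isTop (v∉X ∘ top⇒centre (view v))))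
                                     (sym (¬-not (v∉X ∘ lookup⇒[]= v X)))

  zero-part : ∀ v → (part v ≡ fzero) ⇔ (∃ λ x → (part x ≡ top) × Nbr F x v)
  zero-part v = mk⇔ (λ pv≡0 → let x , x∈X , x~v = to pv≡0 in x , centre⇒top (view x) x∈X , x~v)
                    (λ (x , px≡top , x~v) → from (x , top⇒centre (view x) px≡top , x~v))
    where open Equivalence (zero⇔touches (view v))

  nonzero-parts : ∀ i → 1 ≤ toℕ i → ThreeIndependent F (λ v → part v ≡ i)
  nonzero-parts i 1≤i u w pu≡i pw≡i u≢w s s<4 path =
    separated (view u) (view w) (trans pu≡i (sym pw≡i)) (i≢0 1≤i ∘ trans (sym pu≡i))
              (u≢w , s , s<4 , path)
    where
    i≢0 : 1 ≤ toℕ i → i ≢ fzero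
    i≢0 () refl

  partition : Partition F (suc (suc K)) ∣ X ∣
  partition = part , size , zero-part
            , (λ x y px≡top py≡top → X-profiles (top⇒centre (view x) px≡top) (top⇒centre (view y) py≡top))
            , nonzero-parts

-- Classifying the vertices of F by profile class: vertices in the same class have
-- equivalent profiles, since both are equivalent to the class representative.
profileClassifier : ∀ {r Δ p n} (F : Hypergraph r n) → MaxDegreeAtMost F Δ → ProfileClassCount r Δ p →
                    Σ (Fin n → Fin p) λ cls → ∀ {x y} → cls x ≡ cls y → ProfileEquiv F x F y
profileClassifier {r} {Δ} {p} {n} F bounded (rep , classify , _) = profileClass , sameClass
  where
  pointed : Fin n → Pointed r Δ
  pointed v = record { nV = n ; graph = F ; bounded = bounded ; vertex = v }
  profileClass : Fin n → Fin p
  profileClass v = proj₁ (classify (pointed v))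
  toRep : ∀ v → PEquiv (pointed v) (rep (profileClass v))
  toRep v = proj₂ (classify (pointed v))
  sameClass : ∀ {x y} → profileClass x ≡ profileClass y → ProfileEquiv F x F y
  sameClass {x} {y} same =
    profileEquiv-trans (toRep x) (profileEquiv-sym (subst (PEquiv (pointed y) ∘ rep) (sym same) (toRep y)))

partitionWithColours : ∀ {r Δ p n} (F : Hypergraph r n) → MaxDegreeAtMost F Δ → ProfileClassCount r Δ p →
            ∀ K → ballBound r Δ ≤ K → ∀ m → m * (p * suc K) ≤ n → Partition F (suc (suc K)) m
partitionWithColours {p = zero} _ _ classes _ _ _ _ = contradiction classes noProfileClasses
partitionWithColours {p = suc _} F bounded classes K B≤K m size
  with distanceColouring F bounded K B≤K | profileClassifier F bounded classes
... | h , h-proper | cls , cls-sound with homogeneousSet m (λ v → combine (cls v) (h v)) size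
...   | X , refl , constant = Assembly.partition F h h-proper X
          (λ x∈X y∈X x~y → h-proper x~y (proj₂ (agree x∈X y∈X)))
          (λ x∈X y∈X → cls-sound (proj₁ (agree x∈X y∈X)))
  where
  -- combine is injective, so vertices of X agree in profile class and colour
  agree : ∀ {x y} → x ∈ₛ X → y ∈ₛ X → cls x ≡ cls y × h x ≡ h y
  agree {x} {y} x∈X y∈X = combine-injective (cls x) (h x) (cls y) (h y) (constant x∈X y∈X)

lemma4p1 : (r Δ : ℕ) → 2 ≤ r → 1 ≤ Δ →
    (p : ℕ) → ProfileClassCount r Δ p →
    (m n : ℕ) → m * (p * (tParam r Δ ∸ 1)) ≤ n →
    (F : Hypergraph r n) → MaxDegreeAtMost F Δ →
    ∃ λ (col : Fin n → Fin (suc (tParam r Δ))) →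
      (classSize col (fromℕ (tParam r Δ)) ≡ m) ×
      (∀ v → (col v ≡ fzero) ⇔ (∃ λ x → (col x ≡ fromℕ (tParam r Δ)) × Nbr F x v)) ×
      (∀ x y → col x ≡ fromℕ (tParam r Δ) → col y ≡ fromℕ (tParam r Δ) → ProfileEquiv F x F y) ×
      (∀ (i : Fin (suc (tParam r Δ))) → 1 ≤ toℕ i → ThreeIndependent F (λ v → col v ≡ i))
lemma4p1 r Δ 2≤r 1≤Δ p classes m n size F bounded =
  partitionInto (tParam r Δ) (ballBound+2≤tParam 2≤r 1≤Δ) size
  where
  -- t = r³Δ³ exceeds the ball bound by at least 2, so t = K + 2 with K ≥ ballBound.
  partitionInto : ∀ T → 2 + ballBound r Δ ≤ T → m * (p * (T ∸ 1)) ≤ n → Partition F T m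
  partitionInto (suc (suc K)) (s≤s (s≤s B≤K)) = partitionWithColours F bounded classes K B≤K m
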